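{- For every integer $k > 2$ with $k \equiv 1, 2, 9, 10 \pmod{12}$, the integer $2^k$ is not separable.
   Context: Two positive integers $m$ and $n$ interlock (and $(m,n)$ is called an interlocking pair) if strictly between any two divisors of $n$ that are both larger than $1$ there lies a divisor of $m$, and strictly between any two divisors of $m$ that are both larger than $1$ there lies a divisor of $n$. A positive integer $n$ is called separable if there exists a positive integer $m$ such that $m$ and $n$ interlock. -}

module Defs where

open import Data.Nat using (ℕ; _<_; _^_)
open import Data.Nat.Divisibility using (_∣_)
open import Data.Product using (_×_; ∃-syntax)

BetweenDivisors : ℕ → ℕ → Set
BetweenDivisors m n =
  ∀ a b → a ∣ n → b ∣ n → 1 < a → 1 < b → a < b →
  ∃[ d ] (d ∣ m × a < d × d < b)

Interlock : ℕ → ℕ → Set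
Interlock m n = 0 < m × 0 < n × BetweenDivisors m n × BetweenDivisors n m

Separable : ℕ → Set
Separable n = 0 < n × ∃[ m ] Interlock m n

{-# OPTIONS --safe #-}
module Submission where

open import Defs
open import Data.Nat using (ℕ; _<_; _^_; _%_)
open import Data.Sum using (_⊎_)
open import Relation.Binary.PropositionalEquality using (_≡_)
open import Relation.Nullary using (¬_)

open import Data.Empty using (⊥; ⊥-elim)
open import Data.Nat
open import Data.Nat.Coprimality as Coprime using (Coprime; coprime?; coprime-divisor)
open import Data.Nat.DivMod using (m≡m%n+[m/n]*n)
open import Data.Nat.Divisibility
open import Data.Nat.Primality using (Prime; prime?; prime⇒irreducible; prime⇒nonZero; prime[2])
open import Data.Nat.Properties
open import Data.Product using (_×_; _,_; ∃-syntax; proj₁; proj₂)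
open import Data.Sum as Sum using (inj₁; inj₂)
open import Function using (_∘_; flip; id)
open import Level using (0ℓ)
open import Relation.Binary.PropositionalEquality using (refl; sym; trans; cong; cong₂; subst; module ≡-Reasoning)
open import Relation.Nullary using (yes; no; contradiction)
open import Relation.Nullary.Decidable using (True; toWitness; ¬?; _⊎-dec_)
open import Relation.Unary using (Pred; Decidable; _⊆_; _∩_; ∁; _≐_)
open import Relation.Unary.Properties using (_∩?_; ∁?)

-- If m interlocks with 2 ^ k, then 1 is the only divisor of m below 2, each
-- interval [2 ^ j, 2 ^ (j + 1)) with 1 ≤ j < k contains exactly one divisor of m, and
-- at most one divisor is ≥ 2 ^ k, so τ m ∈ {k, k + 1}.  On the other hand, the
-- divisors of m in (2, 4), (4, 8) and (8, 16), together with the fact that no two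
-- divisors of m share a dyadic interval, force 3 ^ a ∥ m and q ^ b ∥ m for a prime
-- q ∈ {5, 7, 11, 13} and (a, b) ∈ {(1, 1), (1, 2), (2, 1)}; hence (a + 1)(b + 1),
-- which is 4 or 6, divides τ m.  But for k ≡ 1, 2, 9, 10 (mod 12) neither k nor
-- k + 1 is divisible by 4 or 6.

private variable
  p n : ℕ
  P Q : Pred ℕ 0ℓ

count : Decidable P → ℕ → ℕ → ℕ
count P? a zero = 0
count P? a (suc l) with P? a
... | yes _ = suc (count P? (suc a) l)
... | no  _ = count P? (suc a) l

count-++ : (P? : Decidable P) (a l₁ l₂ : ℕ) →
           count P? a (l₁ + l₂) ≡ count P? a l₁ + count P? (a + l₁) l₂
count-++ P? a zero     l₂ rewrite +-identityʳ a = refl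
count-++ P? a (suc l₁) l₂ rewrite +-suc a l₁ with P? a
... | yes _ = cong suc (count-++ P? (suc a) l₁ l₂)
... | no  _ = count-++ P? (suc a) l₁ l₂

count-none : (P? : Decidable P) (a l : ℕ) →
             (∀ {i} → a ≤ i → i < a + l → ¬ P i) → count P? a l ≡ 0
count-none P? a zero    none = refl
count-none P? a (suc l) none rewrite +-suc a l with P? a
... | yes Pa = contradiction Pa (none ≤-refl (s≤s (m≤m+n a l)))
... | no  _  = count-none P? (suc a) l (none ∘ <⇒≤)

count-pos : (P? : Decidable P) (a l : ℕ) {i : ℕ} →
            a ≤ i → i < a + l → P i → 0 < count P? a l
count-pos P? a zero    a≤i i<a+0 _ rewrite +-identityʳ a = contradiction a≤i (<⇒≱ i<a+0)
count-pos P? a (suc l) a≤i i<a+l Pi rewrite +-suc a l with P? a | m≤n⇒m<n∨m≡n a≤i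
... | yes _  | _         = z<s
... | no ¬Pa | inj₂ refl = contradiction Pi ¬Pa
... | no _   | inj₁ a<i  = count-pos P? (suc a) l a<i i<a+l Pi

count-≤1 : (P? : Decidable P) (a l : ℕ) →
           (∀ {i i′} → a ≤ i → i < i′ → i′ < a + l → P i → P i′ → ⊥) → count P? a l ≤ 1
count-≤1 P? a zero    _      = z≤n
count-≤1 P? a (suc l) unique rewrite +-suc a l with P? a
... | yes Pa = s≤s (≤-reflexive (count-none P? (suc a) l λ a<i i<a+l Pi → unique ≤-refl a<i i<a+l Pa Pi))
... | no  _  = count-≤1 P? (suc a) l (unique ∘ <⇒≤)

count-singleton : (P? : Decidable P) {a : ℕ} → P a → count P? a 1 ≡ 1
count-singleton P? {a} Pa with P? a
... | yes _  = refl
... | no ¬Pa = contradiction Pa ¬Pa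

count-cong : P ≐ Q → (P? : Decidable P) (Q? : Decidable Q) (a l : ℕ) → count P? a l ≡ count Q? a l
count-cong _ P? Q? a zero = refl
count-cong P≐Q@(P⊆Q , Q⊆P) P? Q? a (suc l) with P? a | Q? a
... | yes _  | yes _  = cong suc (count-cong P≐Q P? Q? (suc a) l)
... | no _   | no _   = count-cong P≐Q P? Q? (suc a) l
... | yes Pa | no ¬Qa = contradiction (P⊆Q Pa) ¬Qa
... | no ¬Pa | yes Qa = contradiction (Q⊆P Qa) ¬Pa

count-∩-∁ : (P? : Decidable P) (Q? : Decidable Q) (a l : ℕ) →
            count P? a l ≡ count (P? ∩? Q?) a l + count (P? ∩? ∁? Q?) a l
count-∩-∁ P? Q? a zero = refl
count-∩-∁ P? Q? a (suc l) with P? a | Q? a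
... | yes _ | yes _ = cong suc (count-∩-∁ P? Q? (suc a) l)
... | yes _ | no  _ = trans (cong suc (count-∩-∁ P? Q? (suc a) l)) (sym (+-suc _ _))
... | no  _ | yes _ = count-∩-∁ P? Q? (suc a) l
... | no  _ | no  _ = count-∩-∁ P? Q? (suc a) l

count-bound : (P? : Decidable P) {n N : ℕ} → (∀ {i} → n ≤ i → ¬ P i) → n ≤ N →
              count P? 0 N ≡ count P? 0 n
count-bound P? {n} {N} none n≤N = begin
  count P? 0 N                      ≡⟨ cong (count P? 0) (m+[n∸m]≡n n≤N) ⟨
  count P? 0 (n + (N ∸ n))          ≡⟨ count-++ P? 0 n (N ∸ n) ⟩
  count P? 0 n + count P? n (N ∸ n) ≡⟨ cong (count P? 0 n +_) (count-none P? n (N ∸ n) λ n≤i _ → none n≤i) ⟩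
  count P? 0 n + 0                  ≡⟨ +-identityʳ _ ⟩
  count P? 0 n                      ∎
  where open ≡-Reasoning

no-multiple-between : ∀ p L {i} → p * L < i → i < p * suc L → ¬ p ∣ i
no-multiple-between p L pL<i i<p[1+L] (divides c refl) =
  <⇒≱ (*-cancelˡ-< p L c (subst (p * L <_) (*-comm c p) pL<i))
      (≤-pred (*-cancelˡ-< p c (suc L) (subst (_< p * suc L) (*-comm c p) i<p[1+L])))

count-multiples : (P? : Decidable P) (p : ℕ) .{{_ : NonZero p}} (L : ℕ) →
                  count (P? ∩? (p ∣?_)) 0 (p * L) ≡ count (P? ∘ (p *_)) 0 L
count-multiples P? p@(suc q) zero rewrite *-zeroʳ p = refl
count-multiples P? p@(suc q) (suc L) = begin
  count M 0 (p * suc L)                 ≡⟨ cong (count M 0) (trans (*-suc p L) (+-comm p (p * L))) ⟩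
  count M 0 (p * L + p)                 ≡⟨ count-++ M 0 (p * L) p ⟩
  count M 0 (p * L) + count M (p * L) p ≡⟨ cong₂ _+_ (count-multiples P? p L) block ⟩
  count S 0 L + count S L 1             ≡⟨ count-++ S 0 L 1 ⟨
  count S 0 (L + 1)                     ≡⟨ cong (count S 0) (+-comm L 1) ⟩
  count S 0 (suc L)                     ∎
  where
  open ≡-Reasoning
  M = P? ∩? (p ∣?_)
  S = P? ∘ (p *_)
  no-multiple-inside : count M (suc (p * L)) q ≡ 0
  no-multiple-inside = count-none M (suc (p * L)) q λ {i} pL<i i<pL+p → no-multiple-between p L pL<i
    (subst (i <_) (trans (cong suc (+-comm (p * L) q)) (sym (*-suc p L))) i<pL+p) ∘ proj₂
  block : count M (p * L) p ≡ count S L 1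
  block with P? (p * L) | p ∣? p * L
  ... | _     | no p∤pL = contradiction (m∣m*n L) p∤pL
  ... | yes _ | yes _   = cong suc no-multiple-inside
  ... | no  _ | yes _   = no-multiple-inside

τ : ℕ → ℕ
τ n = count (_∣? n) 0 (suc n)

τ∤ : ℕ → ℕ → ℕ
τ∤ p n = count ((_∣? n) ∩? ∁? (p ∣?_)) 0 (suc n)

count-divisors-bound : (P? : Decidable P) {n N : ℕ} .{{_ : NonZero n}} → P ⊆ (_∣ n) → n < N →
                       count P? 0 N ≡ count P? 0 (suc n)
count-divisors-bound P? P⊆∣n n<N = count-bound P? (λ n<i Pi → <⇒≱ n<i (∣⇒≤ (P⊆∣n Pi))) n<N

∤⇒nonZero : ¬ p ∣ n → NonZero n
∤⇒nonZero {p} {zero}  p∤0 = contradiction (p ∣0) p∤0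
∤⇒nonZero {p} {suc n} _   = _

prime∤⇒coprime : Prime p → ¬ p ∣ n → Coprime p n
prime∤⇒coprime pp p∤n (i∣p , i∣n) with prime⇒irreducible pp i∣p
... | inj₁ i≡1  = i≡1
... | inj₂ refl = contradiction i∣n p∤n

p∤-divisors[p*n]≐p∤-divisors[n] : Prime p → (_∣ p * n) ∩ ∁ (p ∣_) ≐ (_∣ n) ∩ ∁ (p ∣_)
p∤-divisors[p*n]≐p∤-divisors[n] {p} pp =
  (λ (d∣pn , p∤d) → coprime-divisor (Coprime.sym (prime∤⇒coprime pp p∤d)) d∣pn , p∤d) ,
  (λ (d∣n , p∤d) → ∣n⇒∣m*n p d∣n , p∤d)

-- The divisors of p * n divisible by p are p times the divisors of n; for p prime,
-- those not divisible by p are exactly the divisors of n not divisible by p.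
τ[p*n] : Prime p → .{{_ : NonZero n}} → τ (p * n) ≡ τ n + τ∤ p n
τ[p*n] {p} {n} pp = begin
  τ (p * n)
    ≡⟨ count-∩-∁ D (p ∣?_) 0 (suc (p * n)) ⟩
  count (D ∩? (p ∣?_)) 0 (suc (p * n)) + count (D ∩? ∁? (p ∣?_)) 0 (suc (p * n))
    ≡⟨ cong₂ _+_ multiples p∤-divisors ⟩
  τ n + τ∤ p n ∎
  where
  open ≡-Reasoning
  instance
    _ = prime⇒nonZero pp
    _ = m*n≢0 p n
  D = _∣? p * n
  C = (_∣? n) ∩? ∁? (p ∣?_)
  multiples : count (D ∩? (p ∣?_)) 0 (suc (p * n)) ≡ τ n
  multiples = begin
    count (D ∩? (p ∣?_)) 0 (suc (p * n))
      ≡⟨ count-divisors-bound (D ∩? (p ∣?_)) proj₁ (*-monoʳ-< p (n<1+n n)) ⟨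
    count (D ∩? (p ∣?_)) 0 (p * suc n)
      ≡⟨ count-multiples D p (suc n) ⟩
    count (D ∘ (p *_)) 0 (suc n)
      ≡⟨ count-cong (*-cancelˡ-∣ p , *-monoʳ-∣ p) (D ∘ (p *_)) (_∣? n) 0 (suc n) ⟩
    τ n ∎
  p∤-divisors : count (D ∩? ∁? (p ∣?_)) 0 (suc (p * n)) ≡ τ∤ p n
  p∤-divisors = begin
    count (D ∩? ∁? (p ∣?_)) 0 (suc (p * n))
      ≡⟨ count-cong (p∤-divisors[p*n]≐p∤-divisors[n] pp) (D ∩? ∁? (p ∣?_)) C 0 (suc (p * n)) ⟩
    count C 0 (suc (p * n))
      ≡⟨ count-divisors-bound C proj₁ (s≤s (m≤n*m n p)) ⟩
    τ∤ p n ∎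

τ∤[p*n] : Prime p → .{{_ : NonZero n}} → τ∤ p (p * n) ≡ τ∤ p n
τ∤[p*n] {p} {n} pp = begin
  τ∤ p (p * n)
    ≡⟨ count-cong (p∤-divisors[p*n]≐p∤-divisors[n] pp) ((_∣? p * n) ∩? ∁? (p ∣?_)) C 0 (suc (p * n)) ⟩
  count C 0 (suc (p * n))
    ≡⟨ count-divisors-bound C proj₁ (s≤s (m≤n*m n p)) ⟩
  τ∤ p n ∎
  where
  open ≡-Reasoning
  instance _ = prime⇒nonZero pp
  C = (_∣? n) ∩? ∁? (p ∣?_)

τ∤≡τ : ¬ p ∣ n → τ∤ p n ≡ τ n
τ∤≡τ {p} {n} p∤n = count-cong (proj₁ , λ d∣n → d∣n , λ p∣d → p∤n (∣-trans p∣d d∣n))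
                               ((_∣? n) ∩? ∁? (p ∣?_)) (_∣? n) 0 (suc n)

τ∤[p^e*n] : Prime p → .{{_ : NonZero n}} → ∀ e → τ∤ p (p ^ e * n) ≡ τ∤ p n
τ∤[p^e*n] {p} {n} pp zero    = cong (τ∤ p) (*-identityˡ n)
τ∤[p^e*n] {p} {n} pp (suc e) = begin
  τ∤ p (p * p ^ e * n)   ≡⟨ cong (τ∤ p) (*-assoc p (p ^ e) n) ⟩
  τ∤ p (p * (p ^ e * n)) ≡⟨ τ∤[p*n] pp ⟩
  τ∤ p (p ^ e * n)       ≡⟨ τ∤[p^e*n] pp e ⟩
  τ∤ p n                 ∎
  where
  open ≡-Reasoning
  instance
    _ = prime⇒nonZero pp
    _ = m*n≢0 (p ^ e) n {{m^n≢0 p e}}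

τ[p^e*n] : Prime p → ¬ p ∣ n → ∀ e → τ (p ^ e * n) ≡ suc e * τ n
τ[p^e*n] {p} {n} pp p∤n zero    = trans (cong τ (*-identityˡ n)) (sym (+-identityʳ (τ n)))
τ[p^e*n] {p} {n} pp p∤n (suc e) = begin
  τ (p * p ^ e * n)                ≡⟨ cong τ (*-assoc p (p ^ e) n) ⟩
  τ (p * (p ^ e * n))              ≡⟨ τ[p*n] pp ⟩
  τ (p ^ e * n) + τ∤ p (p ^ e * n) ≡⟨ cong₂ _+_ (τ[p^e*n] pp p∤n e) (trans (τ∤[p^e*n] pp e) (τ∤≡τ p∤n)) ⟩
  suc e * τ n + τ n                ≡⟨ +-comm (suc e * τ n) (τ n) ⟩
  suc (suc e) * τ n                ∎
  where
  open ≡-Reasoning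
  instance
    _ = prime⇒nonZero pp
    _ = ∤⇒nonZero p∤n
    _ = m*n≢0 (p ^ e) n {{m^n≢0 p e}}

exact-power-split : ∀ {e} → p ^ e ∣ n → ¬ p ^ suc e ∣ n → ∃[ r ] (n ≡ p ^ e * r × ¬ p ∣ r)
exact-power-split {p} {e = e} (divides r refl) p^1+e∤n =
  r , *-comm r (p ^ e) , λ p∣r → p^1+e∤n (*-monoˡ-∣ (p ^ e) p∣r)

τ-exact-powers : ∀ {q a b} → Prime p → Prime q → Coprime (q ^ b) (p ^ a) →
                 p ^ a ∣ n → ¬ p ^ suc a ∣ n → q ^ b ∣ n → ¬ q ^ suc b ∣ n → suc a * suc b ∣ τ n
τ-exact-powers {p} {q = q} {a} {b} pp qq coprime p^a∣n p^1+a∤n q^b∣n q^1+b∤n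
  with r , refl , p∤r ← exact-power-split {p} {e = a} p^a∣n p^1+a∤n
  with s , refl , q∤s ← exact-power-split {q} {e = b} (coprime-divisor coprime q^b∣n)
                                                       (q^1+b∤n ∘ flip ∣-trans (n∣m*n (p ^ a)))
  = divides (τ s) (begin
    τ (p ^ a * (q ^ b * s)) ≡⟨ τ[p^e*n] pp p∤r a ⟩
    suc a * τ (q ^ b * s)   ≡⟨ cong (suc a *_) (τ[p^e*n] qq q∤s b) ⟩
    suc a * (suc b * τ s)   ≡⟨ *-assoc (suc a) (suc b) (τ s) ⟨
    suc a * suc b * τ s     ≡⟨ *-comm (suc a * suc b) (τ s) ⟩
    τ s * (suc a * suc b)   ∎)
  where open ≡-Reasoning

coprime⇒*∣ : ∀ {a b n} → Coprime a b → a ∣ n → b ∣ n → a * b ∣ n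
coprime⇒*∣ {a} {b} coprime a∣n (divides q refl) =
  *-monoˡ-∣ b (coprime-divisor coprime (subst (a ∣_) (*-comm q b) a∣n))

^-monoʳ-∣ : ∀ m {i j} → i ≤ j → m ^ i ∣ m ^ j
^-monoʳ-∣ m {j = j} z≤n      = 1∣ (m ^ j)
^-monoʳ-∣ m       (s≤s i≤j) = *-monoʳ-∣ m (^-monoʳ-∣ m i≤j)

∣prime^⇒≡prime^ : Prime p → ∀ k {e} → e ∣ p ^ k → ∃[ x ] e ≡ p ^ x
∣prime^⇒≡prime^ pp zero e∣1 = 0 , ∣1⇒≡1 e∣1
∣prime^⇒≡prime^ {p} pp (suc k) {e} e∣p^1+k with p ∣? e
... | yes (divides c refl) =
  let instance _ = prime⇒nonZero pp
      x , c≡p^x = ∣prime^⇒≡prime^ pp k {c} (*-cancelʳ-∣ p (subst (c * p ∣_) (*-comm p (p ^ k)) e∣p^1+k))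
  in suc x , trans (cong (_* p) c≡p^x) (*-comm (p ^ x) p)
... | no p∤e = ∣prime^⇒≡prime^ pp k (coprime-divisor (Coprime.sym (prime∤⇒coprime pp p∤e)) e∣p^1+k)

DyadicallySeparated : ℕ → Set
DyadicallySeparated m = ∀ j {a b} → a ∣ m → b ∣ m → a < b → 2 ^ j ≤ a → b < 2 ^ suc j → ⊥

DivisorBetween : ℕ → ℕ → ℕ → Set
DivisorBetween m a b = ∃[ d ] (d ∣ m × a < d × d < b)

1<2 : 1 < 2
1<2 = s<s z<s

no-power-of-two-between : ∀ {j a b} x → 2 ^ j ≤ a → a < 2 ^ x → 2 ^ x < b → b < 2 ^ suc j → ⊥
no-power-of-two-between {j} x 2^j≤a a<2^x 2^x<b b<2^[1+j] with x ≤? j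
... | yes x≤j = <⇒≱ a<2^x (≤-trans (^-monoʳ-≤ 2 x≤j) 2^j≤a)
... | no  x≰j = <⇒≱ (<-trans 2^x<b b<2^[1+j]) (^-monoʳ-≤ 2 (≰⇒> x≰j))

between-powers-of-two⇒separated : ∀ {k m} → BetweenDivisors (2 ^ k) m → DyadicallySeparated m
between-powers-of-two⇒separated B zero _ _ a<b 1≤a b<2 = <⇒≱ (≤-<-trans 1≤a a<b) (≤-pred b<2)
between-powers-of-two⇒separated {k} B (suc j) {a} {b} a∣m b∣m a<b 2^[1+j]≤a b<2^[2+j]
  with B a b a∣m b∣m 1<a (<-trans 1<a a<b) a<b
  where 1<a = <-≤-trans (^-monoʳ-< 2 1<2 (z<s {j})) 2^[1+j]≤a
... | e , e∣2^k , a<e , e<b with ∣prime^⇒≡prime^ prime[2] k e∣2^k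
... | x , refl = no-power-of-two-between {suc j} x 2^[1+j]≤a a<e e<b b<2^[2+j]

divisor-between-powers : ∀ {k m j} → BetweenDivisors m (2 ^ k) → 1 ≤ j → j < k →
                         DivisorBetween m (2 ^ j) (2 ^ suc j)
divisor-between-powers {j = j} B 1≤j j<k =
  B (2 ^ j) (2 ^ suc j) (^-monoʳ-∣ 2 (<⇒≤ j<k)) (^-monoʳ-∣ 2 j<k)
    (^-monoʳ-< 2 1<2 1≤j) (^-monoʳ-< 2 1<2 (z<s {j})) (^-monoʳ-< 2 1<2 (n<1+n j))

count-dyadic-block : ∀ {m j} → DyadicallySeparated m → DivisorBetween m (2 ^ j) (2 ^ suc j) →
                     count (_∣? m) (2 ^ j) (2 ^ j) ≡ 1
count-dyadic-block {m} {j} sep (d , d∣m , 2^j<d , d<2^[1+j]) = ≤-antisym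
  (count-≤1 (_∣? m) (2 ^ j) (2 ^ j) λ {i} {i′} 2^j≤i i<i′ i′<2^j+2^j i∣m i′∣m →
    sep j i∣m i′∣m i<i′ 2^j≤i (subst (i′ <_) (sym 2^[1+j]≡2^j+2^j) i′<2^j+2^j))
  (count-pos (_∣? m) (2 ^ j) (2 ^ j) (<⇒≤ 2^j<d) (subst (d <_) 2^[1+j]≡2^j+2^j d<2^[1+j]) d∣m)
  where
  2^[1+j]≡2^j+2^j : 2 ^ suc j ≡ 2 ^ j + 2 ^ j
  2^[1+j]≡2^j+2^j = cong (2 ^ j +_) (+-identityʳ (2 ^ j))

count-divisors-below-2 : ∀ m .{{_ : NonZero m}} → count (_∣? m) 0 2 ≡ 1
count-divisors-below-2 m with 0 ∣? m
... | yes 0∣m = contradiction (0∣⇒≡0 0∣m) (≢-nonZero⁻¹ m)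
... | no  _   = count-singleton (_∣? m) (1∣ m)

count-divisors-below-power : ∀ {m k} .{{_ : NonZero m}} → DyadicallySeparated m →
  (∀ {j} → 1 ≤ j → j < k → DivisorBetween m (2 ^ j) (2 ^ suc j)) →
  ∀ j → j < k → count (_∣? m) 0 (2 ^ suc j) ≡ suc j
count-divisors-below-power {m} sep between zero    _     = count-divisors-below-2 m
count-divisors-below-power {m} sep between (suc j) 1+j<k = begin
  count (_∣? m) 0 (2 ^ suc j + (2 ^ suc j + 0))
    ≡⟨ cong (λ l → count (_∣? m) 0 (2 ^ suc j + l)) (+-identityʳ _) ⟩
  count (_∣? m) 0 (2 ^ suc j + 2 ^ suc j)
    ≡⟨ count-++ (_∣? m) 0 (2 ^ suc j) (2 ^ suc j) ⟩
  count (_∣? m) 0 (2 ^ suc j) + count (_∣? m) (2 ^ suc j) (2 ^ suc j)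
    ≡⟨ cong₂ _+_ (count-divisors-below-power sep between j (<⇒≤ 1+j<k))
                 (count-dyadic-block {j = suc j} sep (between z<s 1+j<k)) ⟩
  suc j + 1
    ≡⟨ +-comm (suc j) 1 ⟩
  suc (suc j) ∎
  where open ≡-Reasoning

count-divisors-from-power≤1 : ∀ {m k} → 1 ≤ k → BetweenDivisors (2 ^ k) m → ∀ l →
                              count (_∣? m) (2 ^ k) l ≤ 1
count-divisors-from-power≤1 {m} {k} 1≤k B l =
  count-≤1 (_∣? m) (2 ^ k) l λ {i} {i′} 2^k≤i i<i′ _ i∣m i′∣m →
  let 1<i = <-≤-trans (^-monoʳ-< 2 1<2 1≤k) 2^k≤i
      e , e∣2^k , i<e , _ = B i i′ i∣m i′∣m 1<i (<-trans 1<i i<i′) i<i′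
  in <⇒≱ i<e (≤-trans (∣⇒≤ {{m^n≢0 2 k}} e∣2^k) 2^k≤i)

τ-interlocking-power-of-two : ∀ {m k} .{{_ : NonZero m}} → 1 ≤ k →
  BetweenDivisors m (2 ^ k) → BetweenDivisors (2 ^ k) m → τ m ≡ k ⊎ τ m ≡ suc k
τ-interlocking-power-of-two {m} {k@(suc j)} 1≤k B₁ B₂ =
  Sum.map (λ tail≡0 → trans τ≡k+tail (trans (cong (k +_) tail≡0) (+-identityʳ k)))
          (λ tail≡1 → trans τ≡k+tail (trans (cong (k +_) tail≡1) (+-comm k 1)))
          (n≤1⇒n≡0∨n≡1 (count-divisors-from-power≤1 1≤k B₂ (suc m)))
  where
  open ≡-Reasoning
  tail = count (_∣? m) (2 ^ k) (suc m)
  τ≡k+tail : τ m ≡ k + tail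
  τ≡k+tail = begin
    τ m                             ≡⟨ count-divisors-bound (_∣? m) id (m≤n+m (suc m) (2 ^ k)) ⟨
    count (_∣? m) 0 (2 ^ k + suc m) ≡⟨ count-++ (_∣? m) 0 (2 ^ k) (suc m) ⟩
    count (_∣? m) 0 (2 ^ k) + tail  ≡⟨ cong (_+ tail) (count-divisors-below-power {m} {k}
                                         (between-powers-of-two⇒separated {k} B₂)
                                         (divisor-between-powers {k} B₁) j ≤-refl) ⟩
    k + tail                        ∎

DivisibleBy4or6 : ℕ → Set
DivisibleBy4or6 n = 4 ∣ n ⊎ 6 ∣ n

module _ {m} (sep : DyadicallySeparated m)
         (d₁ : DivisorBetween m 2 4) (d₂ : DivisorBetween m 4 8) (d₃ : DivisorBetween m 8 16) where

  private
    collide : ∀ j a b → a ∣ m → b ∣ m →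
              {_ : True (a <? b)} {_ : True (2 ^ j ≤? a)} {_ : True (b <? 2 ^ suc j)} → ⊥
    collide j a b a∣m b∣m {a<b} {lo} {hi} = sep j a∣m b∣m (toWitness a<b) (toWitness lo) (toWitness hi)

    _·_ : ∀ {a b} {_ : True (coprime? a b)} → a ∣ m → b ∣ m → a * b ∣ m
    _·_ {_} {_} {coprime} = coprime⇒*∣ (toWitness coprime)

    exact : ∀ p a q b {_ : True (prime? p)} {_ : True (prime? q)} {_ : True (coprime? (q ^ b) (p ^ a))} →
            p ^ a ∣ m → ¬ p ^ suc a ∣ m → q ^ b ∣ m → ¬ q ^ suc b ∣ m → suc a * suc b ∣ τ m
    exact p a q b {pp} {qq} {coprime} =
      τ-exact-powers {a = a} {b} (toWitness pp) (toWitness qq) (toWitness coprime)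

    3∣m : 3 ∣ m
    3∣m = let d , d∣m , 2<d , d<4 = d₁ in subst (_∣ m) (≤-antisym (≤-pred d<4) 2<d) d∣m

    2∤m : ¬ 2 ∣ m
    2∤m 2∣m = collide 1 2 3 2∣m 3∣m

    5∣m⊎7∣m : 5 ∣ m ⊎ 7 ∣ m
    5∣m⊎7∣m = cases d₂
      where
      cases : DivisorBetween m 4 8 → 5 ∣ m ⊎ 7 ∣ m
      cases (d , d∣m , 4<d , d<8) with m≤n⇒m<n∨m≡n 4<d
      ... | inj₂ refl = inj₁ d∣m
      ... | inj₁ 5<d with m≤n⇒m<n∨m≡n 5<d
      ... | inj₂ refl = contradiction (∣-trans (divides 3 refl) d∣m) 2∤m
      ... | inj₁ 6<d  = inj₂ (subst (_∣ m) (≤-antisym (≤-pred d<8) 6<d) d∣m)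

    5∣m⇒7∤m : 5 ∣ m → ¬ 7 ∣ m
    5∣m⇒7∤m 5∣m 7∣m = collide 2 5 7 5∣m 7∣m

    9∣m⇒6∣τm : 9 ∣ m → 6 ∣ τ m
    9∣m⇒6∣τm 9∣m = exact 3 2 7 1 9∣m 27∤m 7∣m 49∤m
      where
      7∣m : 7 ∣ m
      7∣m = Sum.[ (λ 5∣m → ⊥-elim (collide 3 9 15 9∣m (3∣m · 5∣m))) , id ] 5∣m⊎7∣m
      27∤m : ¬ 27 ∣ m
      27∤m 27∣m = collide 4 21 27 (3∣m · 7∣m) 27∣m
      49∤m : ¬ 49 ∣ m
      49∤m 49∣m = collide 5 49 63 49∣m (9∣m · 7∣m)

    9∤m∧5∣m⇒4or6∣τm : ¬ 9 ∣ m → 5 ∣ m → DivisibleBy4or6 (τ m)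
    9∤m∧5∣m⇒4or6∣τm 9∤m 5∣m with 25 ∣? m
    ... | no  25∤m = inj₁ (exact 3 1 5 1 3∣m 9∤m 5∣m 25∤m)
    ... | yes 25∣m = inj₂ (exact 3 1 5 2 3∣m 9∤m 25∣m λ 125∣m → collide 6 75 125 (3∣m · 25∣m) 125∣m)

    9∤m∧49∣m⇒4∣τm : ¬ 9 ∣ m → 7 ∣ m → 49 ∣ m → 4 ∣ τ m
    9∤m∧49∣m⇒4∣τm 9∤m 7∣m 49∣m = cases d₃
      where
      even∤m : ∀ {d} → 2 ∣ d → ¬ d ∣ m
      even∤m 2∣d d∣m = 2∤m (∣-trans 2∣d d∣m)
      cases : DivisorBetween m 8 16 → 4 ∣ τ m
      cases (d , d∣m , 8<d , d<16) with m≤n⇒m<n∨m≡n 8<d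
      ... | inj₂ refl = contradiction d∣m 9∤m
      ... | inj₁ 9<d with m≤n⇒m<n∨m≡n 9<d
      ... | inj₂ refl = contradiction d∣m (even∤m (divides 5 refl))
      ... | inj₁ 10<d with m≤n⇒m<n∨m≡n 10<d
      ... | inj₂ refl = exact 3 1 11 1 3∣m 9∤m d∣m λ 121∣m → collide 6 77 121 (7∣m · d∣m) 121∣m
      ... | inj₁ 11<d with m≤n⇒m<n∨m≡n 11<d
      ... | inj₂ refl = contradiction d∣m (even∤m (divides 6 refl))
      ... | inj₁ 12<d with m≤n⇒m<n∨m≡n 12<d
      ... | inj₂ refl = exact 3 1 13 1 3∣m 9∤m d∣m λ 169∣m → collide 7 147 169 (3∣m · 49∣m) 169∣m
      ... | inj₁ 13<d with m≤n⇒m<n∨m≡n 13<d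
      ... | inj₂ refl = contradiction d∣m (even∤m (divides 7 refl))
      ... | inj₁ 14<d =
        let 15∣m = subst (_∣ m) (≤-antisym (≤-pred d<16) 14<d) d∣m
        in contradiction 7∣m (5∣m⇒7∤m (∣-trans (divides 3 refl) 15∣m))

    9∤m∧7∣m⇒4or6∣τm : ¬ 9 ∣ m → 7 ∣ m → DivisibleBy4or6 (τ m)
    9∤m∧7∣m⇒4or6∣τm 9∤m 7∣m with 49 ∣? m
    ... | no  49∤m = inj₁ (exact 3 1 7 1 3∣m 9∤m 7∣m 49∤m)
    ... | yes 49∣m with 343 ∣? m
    ... | no  343∤m = inj₂ (exact 3 1 7 2 3∣m 9∤m 49∣m 343∤m)
    ... | yes _     = inj₁ (9∤m∧49∣m⇒4∣τm 9∤m 7∣m 49∣m)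

  τ-divisibleBy4or6 : DivisibleBy4or6 (τ m)
  τ-divisibleBy4or6 with 9 ∣? m | 5∣m⊎7∣m
  ... | yes 9∣m | _        = inj₂ (9∣m⇒6∣τm 9∣m)
  ... | no  9∤m | inj₁ 5∣m = 9∤m∧5∣m⇒4or6∣τm 9∤m 5∣m
  ... | no  9∤m | inj₂ 7∣m = 9∤m∧7∣m⇒4or6∣τm 9∤m 7∣m

ExcludedResidue : ℕ → Set
ExcludedResidue r = r ≡ 1 ⊎ r ≡ 2 ⊎ r ≡ 9 ⊎ r ≡ 10

2<k∧excluded⇒3<k : ∀ {k} → 2 < k → ExcludedResidue (k % 12) → 3 < k
2<k∧excluded⇒3<k 2<k k%12 =
  ≤∧≢⇒< 2<k λ 3≡k → 3-not-excluded (subst (ExcludedResidue ∘ (_% 12)) (sym 3≡k) k%12)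
  where
  3-not-excluded : ¬ ExcludedResidue 3
  3-not-excluded (inj₁ ())
  3-not-excluded (inj₂ (inj₁ ()))
  3-not-excluded (inj₂ (inj₂ (inj₁ ())))
  3-not-excluded (inj₂ (inj₂ (inj₂ ())))

¬divisibleBy4or6 : ∀ c {_ : True (¬? ((4 ∣? c) ⊎-dec (6 ∣? c)))} → ¬ DivisibleBy4or6 c
¬divisibleBy4or6 _ {c∤} = toWitness c∤

excluded⇒¬divisibleBy4or6 : ∀ {r} → ExcludedResidue r → ¬ DivisibleBy4or6 r × ¬ DivisibleBy4or6 (suc r)
excluded⇒¬divisibleBy4or6 (inj₁ refl)               = ¬divisibleBy4or6 1  , ¬divisibleBy4or6 2
excluded⇒¬divisibleBy4or6 (inj₂ (inj₁ refl))        = ¬divisibleBy4or6 2  , ¬divisibleBy4or6 3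
excluded⇒¬divisibleBy4or6 (inj₂ (inj₂ (inj₁ refl))) = ¬divisibleBy4or6 9  , ¬divisibleBy4or6 10
excluded⇒¬divisibleBy4or6 (inj₂ (inj₂ (inj₂ refl))) = ¬divisibleBy4or6 10 , ¬divisibleBy4or6 11

divisibleBy4or6-mod-12 : ∀ c q → DivisibleBy4or6 (c + q * 12) → DivisibleBy4or6 c
divisibleBy4or6-mod-12 c q = Sum.map (cancel (divides 3 refl)) (cancel (divides 2 refl))
  where
  cancel : ∀ {d} → d ∣ 12 → d ∣ c + q * 12 → d ∣ c
  cancel {d} d∣12 d∣c+12q = ∣m+n∣m⇒∣n (subst (d ∣_) (+-comm c (q * 12)) d∣c+12q) (∣n⇒∣m*n q d∣12)

excluded⇒¬divisibleBy4or6-near : ∀ k → ExcludedResidue (k % 12) → ∀ {t} → t ≡ k ⊎ t ≡ suc k →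
                                 ¬ DivisibleBy4or6 t
excluded⇒¬divisibleBy4or6-near k k%12 (inj₁ refl) =
  proj₁ (excluded⇒¬divisibleBy4or6 k%12) ∘ divisibleBy4or6-mod-12 (k % 12) (k / 12)
    ∘ subst DivisibleBy4or6 (m≡m%n+[m/n]*n k 12)
excluded⇒¬divisibleBy4or6-near k k%12 (inj₂ refl) =
  proj₂ (excluded⇒¬divisibleBy4or6 k%12) ∘ divisibleBy4or6-mod-12 (suc (k % 12)) (k / 12)
    ∘ subst DivisibleBy4or6 (cong suc (m≡m%n+[m/n]*n k 12))

mainTheorem2 : ∀ (k : ℕ) → 2 < k →
    (k % 12 ≡ 1 ⊎ k % 12 ≡ 2 ⊎ k % 12 ≡ 9 ⊎ k % 12 ≡ 10) →
    ¬ Separable (2 ^ k)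
mainTheorem2 k 2<k k%12 (_ , m , 0<m , _ , B₁ , B₂) =
  excluded⇒¬divisibleBy4or6-near k k%12 (τ-interlocking-power-of-two (<-trans z<s 2<k) B₁ B₂)
    (τ-divisibleBy4or6 (between-powers-of-two⇒separated {k} B₂)
      (divisor-between-powers B₁ ≤-refl (<-trans 1<2 2<k))
      (divisor-between-powers B₁ (s≤s z≤n) 2<k)
      (divisor-between-powers B₁ (s≤s z≤n) (2<k∧excluded⇒3<k 2<k k%12)))
  where instance _ = >-nonZero 0<m
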